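{- Let $\psi$ be an LTL formula, $\varphi=\mathbf G\psi$, and let $B$ be the basis of $\varphi$. Then for every $C\subseteq B$ the formulas $\mathbf G\psi$, $\psi\,\mathbf U\,\mathbf G(\psi\langle C\rangle_\nu)$, and $\mathbf G(\psi\langle C\rangle_\nu)\,\mathbf R\,\psi$ are pairwise equivalent under the context $\langle C,B\rangle$.
   Context: LTL formulas over a finite set $Ap$ are in negation normal form, generated by $\mathbf{tt},\mathbf{ff},a,\overline a$, $\wedge,\vee,\mathbf X,\mathbf U,\mathbf W,\mathbf R,\mathbf M$ with standard semantics on infinite words over $2^{Ap}$ ($w_i$ suffix from $i$; $\varphi\mathbf U\psi$: $\exists k.\,w_k\models\psi\wedge\forall j<k.\,w_j\models\varphi$; $\varphi\mathbf M\psi$: $\exists k.\,w_k\models\varphi\wedge\forall j\le k.\,w_j\models\psi$; $\varphi\mathbf R\psi$: $\forall k.\,w_k\models\psi$ or $\varphi\mathbf M\psi$; $\varphi\mathbf W\psi$: $\forall k.\,w_k\models\varphi$ or $\varphi\mathbf U\psi$); $\mathbf F\varphi=\mathbf{tt}\mathbf U\varphi$, $\mathbf G\varphi=\varphi\mathbf W\mathbf{ff}$. For a set $S$ of formulas and $C\subseteq S$, $\mathcal L\langle C,S\rangle$ is the set of words satisfying all of $C$ and none of $S\setminus C$; equivalence under $\langle C,S\rangle$ means agreement on all words of $\mathcal L\langle C,S\rangle$. The basis of $\varphi$ is $B=B_{\mathbf{GF}}\cup B_{\mathbf{FG}}$ with $B_{\mathbf{GF}}=\{\mathbf G\mathbf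 F\chi\mid\exists\chi'.\,\chi'\mathbf U\chi\in sf(\varphi)\text{ or }\chi\mathbf M\chi'\in sf(\varphi)\}$ and $B_{\mathbf{FG}}=\{\mathbf F\mathbf G\chi\mid\exists\chi'.\,\chi\mathbf W\chi'\in sf(\varphi)\text{ or }\chi'\mathbf R\chi\in sf(\varphi)\}$ ($sf$ = subformulas). $\chi\langle C\rangle_\nu$: $\chi$ for $\mathbf{tt},\mathbf{ff},a,\overline a$; homomorphic for $\wedge,\vee,\mathbf X,\mathbf W,\mathbf R$; $(\chi_1\mathbf U\chi_2)\langle C\rangle_\nu=\chi_1\langle C\rangle_\nu\mathbf W\chi_2\langle C\rangle_\nu$ if $\mathbf G\mathbf F\chi_2\in C$, else $\mathbf{ff}$; $(\chi_1\mathbf M\chi_2)\langle C\rangle_\nu=\chi_1\langle C\rangle_\nu\mathbf R\chi_2\langle C\rangle_\nu$ if $\mathbf G\mathbf F\chi_1\in C$, else $\mathbf{ff}$. -}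

module Defs where

open import Data.Nat using (ℕ; _+_; _<_; _≤_)
open import Data.Fin using (Fin)
import Data.Fin.Properties as Fin
open import Data.Fin.Subset using (Subset; _∈_; _∉_)
open import Data.Bool using (Bool; true; false)
open import Data.List using (List; []; _∷_; _++_; concatMap)
open import Data.List.Relation.Unary.All using (All)
import Data.List.Membership.Propositional as MemP
open import Data.List.Relation.Binary.Subset.Propositional using (_⊆_)
open import Data.Product using (Σ; ∃; _×_; _,_)
open import Data.Product.Properties using (≡-dec)
open import Data.Sum using (_⊎_)
open import Data.Unit using (⊤)
open import Data.Empty using (⊥)
open import Relation.Nullary using (¬_; Dec; yes; no)
open import Relation.Nullary.Decidable using (map′; _×-dec_)
open import Relation.Binary.PropositionalEquality using (_≡_; refl; cong)
open import Relation.Binary.Definitions using (DecidableEquality)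
open import Function.Bundles using (_⇔_)

-- LTL formulas in negation normal form over Ap = Fin n

infixr 6 _∧_ _∨_
infixr 7 _U_ _W_ _R_ _M_

data LTL (n : ℕ) : Set where
  tt ff : LTL n
  at nat : Fin n → LTL n
  _∧_ _∨_ : LTL n → LTL n → LTL n
  X : LTL n → LTL n
  _U_ _W_ _R_ _M_ : LTL n → LTL n → LTL n

module _ {n : ℕ} where

  F G : LTL n → LTL n
  F φ = tt U φ
  G φ = φ W ff

  infix 4 _≟_
  _≟_ : DecidableEquality (LTL n)
  tt ≟ tt = yes refl
  tt ≟ ff = no λ ()
  tt ≟ (at ay) = no λ ()
  tt ≟ (nat ay) = no λ ()
  tt ≟ (y1 ∧ y2) = no λ ()
  tt ≟ (y1 ∨ y2) = no λ ()
  tt ≟ (X fy) = no λ ()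
  tt ≟ (y1 U y2) = no λ ()
  tt ≟ (y1 W y2) = no λ ()
  tt ≟ (y1 R y2) = no λ ()
  tt ≟ (y1 M y2) = no λ ()
  ff ≟ tt = no λ ()
  ff ≟ ff = yes refl
  ff ≟ (at ay) = no λ ()
  ff ≟ (nat ay) = no λ ()
  ff ≟ (y1 ∧ y2) = no λ ()
  ff ≟ (y1 ∨ y2) = no λ ()
  ff ≟ (X fy) = no λ ()
  ff ≟ (y1 U y2) = no λ ()
  ff ≟ (y1 W y2) = no λ ()
  ff ≟ (y1 R y2) = no λ ()
  ff ≟ (y1 M y2) = no λ ()
  (at ax) ≟ tt = no λ ()
  (at ax) ≟ ff = no λ ()
  (at ax) ≟ (at ay) = map′ (cong at) (λ { refl → refl }) (Fin._≟_ ax ay)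
  (at ax) ≟ (nat ay) = no λ ()
  (at ax) ≟ (y1 ∧ y2) = no λ ()
  (at ax) ≟ (y1 ∨ y2) = no λ ()
  (at ax) ≟ (X fy) = no λ ()
  (at ax) ≟ (y1 U y2) = no λ ()
  (at ax) ≟ (y1 W y2) = no λ ()
  (at ax) ≟ (y1 R y2) = no λ ()
  (at ax) ≟ (y1 M y2) = no λ ()
  (nat ax) ≟ tt = no λ ()
  (nat ax) ≟ ff = no λ ()
  (nat ax) ≟ (at ay) = no λ ()
  (nat ax) ≟ (nat ay) = map′ (cong nat) (λ { refl → refl }) (Fin._≟_ ax ay)
  (nat ax) ≟ (y1 ∧ y2) = no λ ()
  (nat ax) ≟ (y1 ∨ y2) = no λ ()
  (nat ax) ≟ (X fy) = no λ ()
  (nat ax) ≟ (y1 U y2) = no λ ()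
  (nat ax) ≟ (y1 W y2) = no λ ()
  (nat ax) ≟ (y1 R y2) = no λ ()
  (nat ax) ≟ (y1 M y2) = no λ ()
  (x1 ∧ x2) ≟ tt = no λ ()
  (x1 ∧ x2) ≟ ff = no λ ()
  (x1 ∧ x2) ≟ (at ay) = no λ ()
  (x1 ∧ x2) ≟ (nat ay) = no λ ()
  (x1 ∧ x2) ≟ (y1 ∧ y2) = map′ (λ { (refl , refl) → refl }) (λ { refl → refl , refl }) ((x1 ≟ y1) ×-dec (x2 ≟ y2))
  (x1 ∧ x2) ≟ (y1 ∨ y2) = no λ ()
  (x1 ∧ x2) ≟ (X fy) = no λ ()
  (x1 ∧ x2) ≟ (y1 U y2) = no λ ()
  (x1 ∧ x2) ≟ (y1 W y2) = no λ ()
  (x1 ∧ x2) ≟ (y1 R y2) = no λ ()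
  (x1 ∧ x2) ≟ (y1 M y2) = no λ ()
  (x1 ∨ x2) ≟ tt = no λ ()
  (x1 ∨ x2) ≟ ff = no λ ()
  (x1 ∨ x2) ≟ (at ay) = no λ ()
  (x1 ∨ x2) ≟ (nat ay) = no λ ()
  (x1 ∨ x2) ≟ (y1 ∧ y2) = no λ ()
  (x1 ∨ x2) ≟ (y1 ∨ y2) = map′ (λ { (refl , refl) → refl }) (λ { refl → refl , refl }) ((x1 ≟ y1) ×-dec (x2 ≟ y2))
  (x1 ∨ x2) ≟ (X fy) = no λ ()
  (x1 ∨ x2) ≟ (y1 U y2) = no λ ()
  (x1 ∨ x2) ≟ (y1 W y2) = no λ ()
  (x1 ∨ x2) ≟ (y1 R y2) = no λ ()
  (x1 ∨ x2) ≟ (y1 M y2) = no λ ()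
  (X fx) ≟ tt = no λ ()
  (X fx) ≟ ff = no λ ()
  (X fx) ≟ (at ay) = no λ ()
  (X fx) ≟ (nat ay) = no λ ()
  (X fx) ≟ (y1 ∧ y2) = no λ ()
  (X fx) ≟ (y1 ∨ y2) = no λ ()
  (X x) ≟ (X y) = map′ (cong X) (λ { refl → refl }) (x ≟ y)
  (X fx) ≟ (y1 U y2) = no λ ()
  (X fx) ≟ (y1 W y2) = no λ ()
  (X fx) ≟ (y1 R y2) = no λ ()
  (X fx) ≟ (y1 M y2) = no λ ()
  (x1 U x2) ≟ tt = no λ ()
  (x1 U x2) ≟ ff = no λ ()
  (x1 U x2) ≟ (at ay) = no λ ()
  (x1 U x2) ≟ (nat ay) = no λ ()
  (x1 U x2) ≟ (y1 ∧ y2) = no λ ()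
  (x1 U x2) ≟ (y1 ∨ y2) = no λ ()
  (x1 U x2) ≟ (X fy) = no λ ()
  (x1 U x2) ≟ (y1 U y2) = map′ (λ { (refl , refl) → refl }) (λ { refl → refl , refl }) ((x1 ≟ y1) ×-dec (x2 ≟ y2))
  (x1 U x2) ≟ (y1 W y2) = no λ ()
  (x1 U x2) ≟ (y1 R y2) = no λ ()
  (x1 U x2) ≟ (y1 M y2) = no λ ()
  (x1 W x2) ≟ tt = no λ ()
  (x1 W x2) ≟ ff = no λ ()
  (x1 W x2) ≟ (at ay) = no λ ()
  (x1 W x2) ≟ (nat ay) = no λ ()
  (x1 W x2) ≟ (y1 ∧ y2) = no λ ()
  (x1 W x2) ≟ (y1 ∨ y2) = no λ ()
  (x1 W x2) ≟ (X fy) = no λ ()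
  (x1 W x2) ≟ (y1 U y2) = no λ ()
  (x1 W x2) ≟ (y1 W y2) = map′ (λ { (refl , refl) → refl }) (λ { refl → refl , refl }) ((x1 ≟ y1) ×-dec (x2 ≟ y2))
  (x1 W x2) ≟ (y1 R y2) = no λ ()
  (x1 W x2) ≟ (y1 M y2) = no λ ()
  (x1 R x2) ≟ tt = no λ ()
  (x1 R x2) ≟ ff = no λ ()
  (x1 R x2) ≟ (at ay) = no λ ()
  (x1 R x2) ≟ (nat ay) = no λ ()
  (x1 R x2) ≟ (y1 ∧ y2) = no λ ()
  (x1 R x2) ≟ (y1 ∨ y2) = no λ ()
  (x1 R x2) ≟ (X fy) = no λ ()
  (x1 R x2) ≟ (y1 U y2) = no λ ()
  (x1 R x2) ≟ (y1 W y2) = no λ ()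
  (x1 R x2) ≟ (y1 R y2) = map′ (λ { (refl , refl) → refl }) (λ { refl → refl , refl }) ((x1 ≟ y1) ×-dec (x2 ≟ y2))
  (x1 R x2) ≟ (y1 M y2) = no λ ()
  (x1 M x2) ≟ tt = no λ ()
  (x1 M x2) ≟ ff = no λ ()
  (x1 M x2) ≟ (at ay) = no λ ()
  (x1 M x2) ≟ (nat ay) = no λ ()
  (x1 M x2) ≟ (y1 ∧ y2) = no λ ()
  (x1 M x2) ≟ (y1 ∨ y2) = no λ ()
  (x1 M x2) ≟ (X fy) = no λ ()
  (x1 M x2) ≟ (y1 U y2) = no λ ()
  (x1 M x2) ≟ (y1 W y2) = no λ ()
  (x1 M x2) ≟ (y1 R y2) = no λ ()
  (x1 M x2) ≟ (y1 M y2) = map′ (λ { (refl , refl) → refl }) (λ { refl → refl , refl }) ((x1 ≟ y1) ×-dec (x2 ≟ y2))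

Word : ℕ → Set
Word n = ℕ → Subset n

suffix : ∀ {n} → Word n → ℕ → Word n
suffix w i = λ k → w (i + k)

infix 3 _⊨_
_⊨_ : ∀ {n} → Word n → LTL n → Set
w ⊨ tt = ⊤
w ⊨ ff = ⊥
w ⊨ at a = a ∈ w 0
w ⊨ nat a = a ∉ w 0
w ⊨ φ ∧ ψ = (w ⊨ φ) × (w ⊨ ψ)
w ⊨ φ ∨ ψ = (w ⊨ φ) ⊎ (w ⊨ ψ)
w ⊨ X φ = suffix w 1 ⊨ φ
w ⊨ φ U ψ = ∃ λ k → (suffix w k ⊨ ψ) × (∀ j → j < k → suffix w j ⊨ φ)
w ⊨ φ M ψ = ∃ λ k → (suffix w k ⊨ φ) × (∀ j → j ≤ k → suffix w j ⊨ ψ)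
w ⊨ φ R ψ = (∀ k → suffix w k ⊨ ψ)
          ⊎ (∃ λ k → (suffix w k ⊨ φ) × (∀ j → j ≤ k → suffix w j ⊨ ψ))
w ⊨ φ W ψ = (∀ k → suffix w k ⊨ φ)
          ⊎ (∃ λ k → (suffix w k ⊨ ψ) × (∀ j → j < k → suffix w j ⊨ φ))

sf : ∀ {n} → LTL n → List (LTL n)
sf tt = tt ∷ []
sf ff = ff ∷ []
sf (at a) = at a ∷ []
sf (nat a) = nat a ∷ []
sf (φ ∧ ψ) = (φ ∧ ψ) ∷ sf φ ++ sf ψ
sf (φ ∨ ψ) = (φ ∨ ψ) ∷ sf φ ++ sf ψ
sf (X φ) = X φ ∷ sf φ
sf (φ U ψ) = (φ U ψ) ∷ sf φ ++ sf ψ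
sf (φ W ψ) = (φ W ψ) ∷ sf φ ++ sf ψ
sf (φ R ψ) = (φ R ψ) ∷ sf φ ++ sf ψ
sf (φ M ψ) = (φ M ψ) ∷ sf φ ++ sf ψ

basisOf : ∀ {n} → LTL n → List (LTL n)
basisOf (χ' U χ) = G (F χ) ∷ []
basisOf (χ M χ') = G (F χ) ∷ []
basisOf (χ W χ') = F (G χ) ∷ []
basisOf (χ' R χ) = F (G χ) ∷ []
basisOf _ = []

-- the basis B of φ (as a list; membership is what matters)
basis : ∀ {n} → LTL n → List (LTL n)
basis φ = concatMap basisOf (sf φ)

module _ {n : ℕ} where
  open import Data.List.Membership.DecPropositional (_≟_ {n}) using (_∈?_)

  _⟨_⟩ν : LTL n → List (LTL n) → LTL n
  tt ⟨ C ⟩ν = tt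
  ff ⟨ C ⟩ν = ff
  at a ⟨ C ⟩ν = at a
  nat a ⟨ C ⟩ν = nat a
  (φ ∧ ψ) ⟨ C ⟩ν = (φ ⟨ C ⟩ν) ∧ (ψ ⟨ C ⟩ν)
  (φ ∨ ψ) ⟨ C ⟩ν = (φ ⟨ C ⟩ν) ∨ (ψ ⟨ C ⟩ν)
  X φ ⟨ C ⟩ν = X (φ ⟨ C ⟩ν)
  (φ W ψ) ⟨ C ⟩ν = (φ ⟨ C ⟩ν) W (ψ ⟨ C ⟩ν)
  (φ R ψ) ⟨ C ⟩ν = (φ ⟨ C ⟩ν) R (ψ ⟨ C ⟩ν)
  (φ U ψ) ⟨ C ⟩ν with G (F ψ) ∈? C
  ... | yes _ = (φ ⟨ C ⟩ν) W (ψ ⟨ C ⟩ν)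
  ... | no _ = ff
  (φ M ψ) ⟨ C ⟩ν with G (F φ) ∈? C
  ... | yes _ = (φ ⟨ C ⟩ν) R (ψ ⟨ C ⟩ν)
  ... | no _ = ff

open MemP using () renaming (_∈_ to _∈ₗ_; _∉_ to _∉ₗ_)

InLang : ∀ {n} → List (LTL n) → List (LTL n) → Word n → Set
InLang C S w = All (λ φ → w ⊨ φ) C × (∀ φ → φ ∈ₗ S → φ ∉ₗ C → ¬ (w ⊨ φ))

EquivUnder : ∀ {n} → List (LTL n) → List (LTL n) → LTL n → LTL n → Set
EquivUnder C S φ ψ = ∀ w → InLang C S w → (w ⊨ φ) ⇔ (w ⊨ ψ)

{-# OPTIONS --safe #-}
-- Write ν for ψ⟨C⟩ν.  If every GF χ ∈ C holds on w, then G(ν → ψ) holds on w: a U or M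
-- that ⟨C⟩ν weakens to W or R has its eventuality guaranteed by C, and every other one
-- became ff.  If moreover no GF χ ∈ B ∖ C holds then, classically, each such χ is eventually
-- always false, so the U and M that became ff are eventually false as well and FG(ψ → ν)
-- holds on w.  Hence G ψ holds iff ψ holds up to some position from which G ν holds, which
-- is what both ψ U G ν and G ν R ψ express.
module Submission where

open import Defs
open import Data.Nat using (ℕ; _+_; _∸_; _≤_; _<_; _⊔_; _≤?_)
open import Data.Nat.Properties using (+-assoc; m≤m+n; ≤-trans; m≤m⊔n; m≤n⊔m; m+[n∸m]≡n; ≰⇒>; <⇒≤; ≤-refl)
open import Data.List using (List; _∷_; _++_)
open import Data.List.Relation.Binary.Subset.Propositional using (_⊆_)
open import Data.List.Relation.Unary.All as All using ()
open import Data.List.Relation.Unary.Any as Any using (here; there)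
open import Data.List.Membership.Propositional using () renaming (_∈_ to _∈ₗ_; _∉_ to _∉ₗ_)
open import Data.List.Membership.Propositional.Properties using (∈-concatMap⁺; ∈-++⁺ˡ; ∈-++⁺ʳ)
open import Data.Product using (_×_; _,_; ∃)
open import Data.Sum using (inj₁; inj₂)
open import Data.Fin.Subset using (_∈_; _∉_)
open import Relation.Nullary using (¬_; yes; no)
open import Relation.Binary.PropositionalEquality using (_≗_; refl; sym; subst; cong)
open import Function using (_∘_)
open import Function.Bundles using (mk⇔)
open import Function.Construct.Composition using (_⇔-∘_)
open import Function.Construct.Symmetry using (⇔-sym)
open import Level using (0ℓ)
open import Axiom.ExcludedMiddle using (ExcludedMiddle)
open import Axiom.DoubleNegationElimination using (em⇒dne)

Eventually : (ℕ → Set) → Set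
Eventually P = ∃ λ i → ∀ j → i ≤ j → P j

Eventually-map : ∀ {P Q : ℕ → Set} → (∀ j → P j → Q j) → Eventually P → Eventually Q
Eventually-map f (i , p) = i , λ j i≤j → f j (p j i≤j)

Eventually-zipWith : ∀ {P Q R : ℕ → Set} → (∀ j → P j → Q j → R j) →
                     Eventually P → Eventually Q → Eventually R
Eventually-zipWith f (i , p) (i' , q) =
  i ⊔ i' , λ j i⊔i'≤j → f j (p j (≤-trans (m≤m⊔n i i') i⊔i'≤j)) (q j (≤-trans (m≤n⊔m i i') i⊔i'≤j))

Eventually-always : ∀ {P : ℕ → Set} → Eventually P → Eventually (λ j → ∀ k → P (j + k))
Eventually-always (i , p) = i , λ j i≤j k → p (j + k) (≤-trans i≤j (m≤m+n j k))

module _ {n : ℕ} where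
  open import Data.List.Membership.DecPropositional (_≟_ {n}) using (_∈?_)

  ⊨-cong : ∀ (φ : LTL n) {u v : Word n} → u ≗ v → u ⊨ φ → v ⊨ φ
  ⊨-cong tt e s = s
  ⊨-cong ff e s = s
  ⊨-cong (at a) e s = subst (a ∈_) (e 0) s
  ⊨-cong (nat a) e s = subst (a ∉_) (e 0) s
  ⊨-cong (φ ∧ ψ) e (p , q) = ⊨-cong φ e p , ⊨-cong ψ e q
  ⊨-cong (φ ∨ ψ) e (inj₁ p) = inj₁ (⊨-cong φ e p)
  ⊨-cong (φ ∨ ψ) e (inj₂ q) = inj₂ (⊨-cong ψ e q)
  ⊨-cong (X φ) e s = ⊨-cong φ (e ∘ (1 +_)) s
  ⊨-cong (φ U ψ) e (k , p , q) =
    k , ⊨-cong ψ (e ∘ (k +_)) p , λ j j<k → ⊨-cong φ (e ∘ (j +_)) (q j j<k)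
  ⊨-cong (φ M ψ) e (k , p , q) =
    k , ⊨-cong φ (e ∘ (k +_)) p , λ j j≤k → ⊨-cong ψ (e ∘ (j +_)) (q j j≤k)
  ⊨-cong (φ R ψ) e (inj₁ a) = inj₁ λ k → ⊨-cong ψ (e ∘ (k +_)) (a k)
  ⊨-cong (φ R ψ) e (inj₂ (k , p , q)) =
    inj₂ (k , ⊨-cong φ (e ∘ (k +_)) p , λ j j≤k → ⊨-cong ψ (e ∘ (j +_)) (q j j≤k))
  ⊨-cong (φ W ψ) e (inj₁ a) = inj₁ λ k → ⊨-cong φ (e ∘ (k +_)) (a k)
  ⊨-cong (φ W ψ) e (inj₂ (k , p , q)) =
    inj₂ (k , ⊨-cong ψ (e ∘ (k +_)) p , λ j j<k → ⊨-cong φ (e ∘ (j +_)) (q j j<k))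

  suffix-suffix⁺ : ∀ φ (u : Word n) a b → suffix (suffix u a) b ⊨ φ → suffix u (a + b) ⊨ φ
  suffix-suffix⁺ φ u a b = ⊨-cong φ (λ i → cong u (sym (+-assoc a b i)))

  suffix-suffix⁻ : ∀ φ (u : Word n) a b → suffix u (a + b) ⊨ φ → suffix (suffix u a) b ⊨ φ
  suffix-suffix⁻ φ u a b = ⊨-cong φ (λ i → cong u (+-assoc a b i))

  suffix-∸⁺ : ∀ φ (u : Word n) {k m} → k ≤ m → suffix (suffix u k) (m ∸ k) ⊨ φ → suffix u m ⊨ φ
  suffix-∸⁺ φ u {k} {m} k≤m = subst (λ i → suffix u i ⊨ φ) (m+[n∸m]≡n k≤m) ∘ suffix-suffix⁺ φ u k (m ∸ k)

  suffix-∸⁻ : ∀ φ (u : Word n) {k m} → k ≤ m → suffix u m ⊨ φ → suffix (suffix u k) (m ∸ k) ⊨ φ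
  suffix-∸⁻ φ u {k} {m} k≤m = suffix-suffix⁻ φ u k (m ∸ k) ∘ subst (λ i → suffix u i ⊨ φ) (sym (m+[n∸m]≡n k≤m))

  G-always : ∀ φ (u : Word n) → u ⊨ G φ → ∀ k → suffix u k ⊨ φ
  G-always φ u (inj₁ always) = always
  G-always φ u (inj₂ (_ , () , _))

  G-suffix : ∀ φ (u : Word n) k → u ⊨ G φ → suffix u k ⊨ G φ
  G-suffix φ u k g = inj₁ λ j → suffix-suffix⁻ φ u k j (G-always φ u g (k + j))

  G-from-prefix : ∀ φ (u : Word n) k → suffix u k ⊨ G φ → (∀ j → j < k → suffix u j ⊨ φ) → u ⊨ G φ
  G-from-prefix φ u k g before = inj₁ everywhere
    where
    everywhere : ∀ j → suffix u j ⊨ φ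
    everywhere j with k ≤? j
    ... | yes k≤j = suffix-∸⁺ φ u k≤j (G-always φ (suffix u k) g (j ∸ k))
    ... | no k≰j = before j (≰⇒> k≰j)

  W∧F⇒U : ∀ φ ψ {u : Word n} → u ⊨ F ψ → u ⊨ φ W ψ → u ⊨ φ U ψ
  W∧F⇒U φ ψ (k , p , _) (inj₁ always) = k , p , λ j _ → always j
  W∧F⇒U φ ψ _ (inj₂ until) = until

  R∧F⇒M : ∀ φ ψ {u : Word n} → u ⊨ F φ → u ⊨ φ R ψ → u ⊨ φ M ψ
  R∧F⇒M φ ψ (k , p , _) (inj₁ always) = k , p , λ j _ → always j
  R∧F⇒M φ ψ _ (inj₂ strong) = strong

  infix 3 _⊨G_⇒_

  -- A record rather than a plain function type, so that u, φ and φ' can be inferred.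
  record _⊨G_⇒_ (u : Word n) (φ φ' : LTL n) : Set where
    constructor G⇒
    field implies : ∀ k → suffix u k ⊨ φ → suffix u k ⊨ φ'

  open _⊨G_⇒_

  ⊨G-refl : ∀ {u φ} → u ⊨G φ ⇒ φ
  ⊨G-refl = G⇒ λ _ s → s

  ⊨G-suffix : ∀ {u φ φ'} → u ⊨G φ ⇒ φ' → ∀ j → suffix u j ⊨G φ ⇒ φ'
  ⊨G-suffix {u} {φ} {φ'} f j =
    G⇒ λ k → suffix-suffix⁻ φ' u j k ∘ implies f (j + k) ∘ suffix-suffix⁺ φ u j k

  G-mp : ∀ {u φ φ'} → u ⊨G φ ⇒ φ' → u ⊨ G φ → u ⊨ G φ'
  G-mp {u} {φ} f g = inj₁ λ k → implies f k (G-always φ u g k)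

  W-mono : ∀ {u φ φ' ψ ψ'} → u ⊨G φ ⇒ φ' → u ⊨G ψ ⇒ ψ' → u ⊨ φ W ψ → u ⊨ φ' W ψ'
  W-mono f g (inj₁ always) = inj₁ λ k → implies f k (always k)
  W-mono f g (inj₂ (k , p , q)) = inj₂ (k , implies g k p , λ j j<k → implies f j (q j j<k))

  R-mono : ∀ {u φ φ' ψ ψ'} → u ⊨G φ ⇒ φ' → u ⊨G ψ ⇒ ψ' → u ⊨ φ R ψ → u ⊨ φ' R ψ'
  R-mono f g (inj₁ always) = inj₁ λ k → implies g k (always k)
  R-mono f g (inj₂ (k , p , q)) = inj₂ (k , implies f k p , λ j j≤k → implies g j (q j j≤k))

  U-mono : ∀ {u φ φ' ψ ψ'} → u ⊨G φ ⇒ φ' → u ⊨G ψ ⇒ ψ' → u ⊨ φ U ψ → u ⊨ φ' U ψ'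
  U-mono f g (k , p , q) = k , implies g k p , λ j j<k → implies f j (q j j<k)

  M-mono : ∀ {u φ φ' ψ ψ'} → u ⊨G φ ⇒ φ' → u ⊨G ψ ⇒ ψ' → u ⊨ φ M ψ → u ⊨ φ' M ψ'
  M-mono f g (k , p , q) = k , implies f k p , λ j j≤k → implies g j (q j j≤k)

  ⊨G-∧ : ∀ {u φ φ' ψ ψ'} → u ⊨G φ ⇒ φ' → u ⊨G ψ ⇒ ψ' → u ⊨G φ ∧ ψ ⇒ φ' ∧ ψ'
  ⊨G-∧ f g = G⇒ λ { k (p , q) → implies f k p , implies g k q }

  ⊨G-∨ : ∀ {u φ φ' ψ ψ'} → u ⊨G φ ⇒ φ' → u ⊨G ψ ⇒ ψ' → u ⊨G φ ∨ ψ ⇒ φ' ∨ ψ'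
  ⊨G-∨ f g = G⇒ λ { k (inj₁ p) → inj₁ (implies f k p) ; k (inj₂ q) → inj₂ (implies g k q) }

  ⊨G-X : ∀ {u φ φ'} → u ⊨G φ ⇒ φ' → u ⊨G X φ ⇒ X φ'
  ⊨G-X f = G⇒ λ k → implies (⊨G-suffix f k) 1

  ⊨G-W : ∀ {u φ φ' ψ ψ'} → u ⊨G φ ⇒ φ' → u ⊨G ψ ⇒ ψ' → u ⊨G φ W ψ ⇒ φ' W ψ'
  ⊨G-W f g = G⇒ λ k → W-mono (⊨G-suffix f k) (⊨G-suffix g k)

  ⊨G-R : ∀ {u φ φ' ψ ψ'} → u ⊨G φ ⇒ φ' → u ⊨G ψ ⇒ ψ' → u ⊨G φ R ψ ⇒ φ' R ψ'
  ⊨G-R f g = G⇒ λ k → R-mono (⊨G-suffix f k) (⊨G-suffix g k)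

  ⊨G-U⇒W : ∀ {u φ φ' ψ ψ'} → u ⊨G φ ⇒ φ' → u ⊨G ψ ⇒ ψ' → u ⊨G φ U ψ ⇒ φ' W ψ'
  ⊨G-U⇒W f g = G⇒ λ k → inj₂ ∘ U-mono (⊨G-suffix f k) (⊨G-suffix g k)

  ⊨G-M⇒R : ∀ {u φ φ' ψ ψ'} → u ⊨G φ ⇒ φ' → u ⊨G ψ ⇒ ψ' → u ⊨G φ M ψ ⇒ φ' R ψ'
  ⊨G-M⇒R f g = G⇒ λ k → inj₂ ∘ M-mono (⊨G-suffix f k) (⊨G-suffix g k)

  ⊨G-W⇒U : ∀ {u φ φ' ψ ψ'} → u ⊨ G (F ψ') → u ⊨G φ ⇒ φ' → u ⊨G ψ ⇒ ψ' → u ⊨G φ W ψ ⇒ φ' U ψ'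
  ⊨G-W⇒U {u} {φ' = φ'} {ψ' = ψ'} gf f g =
    G⇒ λ k → W∧F⇒U φ' ψ' {suffix u k} (G-always (F ψ') u gf k) ∘ W-mono (⊨G-suffix f k) (⊨G-suffix g k)

  ⊨G-R⇒M : ∀ {u φ φ' ψ ψ'} → u ⊨ G (F φ') → u ⊨G φ ⇒ φ' → u ⊨G ψ ⇒ ψ' → u ⊨G φ R ψ ⇒ φ' M ψ'
  ⊨G-R⇒M {u} {φ' = φ'} {ψ' = ψ'} gf f g =
    G⇒ λ k → R∧F⇒M φ' ψ' {suffix u k} (G-always (F φ') u gf k) ∘ R-mono (⊨G-suffix f k) (⊨G-suffix g k)

  ⊨G-U⇒ff : ∀ {u φ ψ} → (∀ k → ¬ (suffix u k ⊨ ψ)) → u ⊨G φ U ψ ⇒ ff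
  ⊨G-U⇒ff {u} {ψ = ψ} never = G⇒ λ { k (m , p , _) → never (k + m) (suffix-suffix⁺ ψ u k m p) }

  ⊨G-M⇒ff : ∀ {u φ ψ} → (∀ k → ¬ (suffix u k ⊨ φ)) → u ⊨G φ M ψ ⇒ ff
  ⊨G-M⇒ff {u} {φ} never = G⇒ λ { k (m , p , _) → never (k + m) (suffix-suffix⁺ φ u k m p) }

  ⊨G-ff : ∀ {u φ} → u ⊨G ff ⇒ φ
  ⊨G-ff = G⇒ λ _ ()

  ¬GF⇒FG¬ : ExcludedMiddle 0ℓ → ∀ χ (u : Word n) → ¬ (u ⊨ G (F χ)) → Eventually (λ j → ¬ (suffix u j ⊨ χ))
  ¬GF⇒FG¬ em χ u ¬GF = dne λ ¬FG¬ → ¬GF (inj₁ λ k → dne λ ¬Fχ →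
    ¬FG¬ (k , λ m k≤m χ-at-m → ¬Fχ (m ∸ k , suffix-∸⁻ χ u k≤m χ-at-m , λ _ _ → _)))
    where dne = em⇒dne em

  SatisfiesGF : List (LTL n) → Word n → Set
  SatisfiesGF C u = ∀ χ → G (F χ) ∈ₗ C → u ⊨ G (F χ)

  ⟨⟩ν-sound : ∀ {C u} χ → SatisfiesGF C u → u ⊨G χ ⟨ C ⟩ν ⇒ χ
  ⟨⟩ν-sound tt _ = ⊨G-refl
  ⟨⟩ν-sound ff _ = ⊨G-refl
  ⟨⟩ν-sound (at a) _ = ⊨G-refl
  ⟨⟩ν-sound (nat a) _ = ⊨G-refl
  ⟨⟩ν-sound (φ ∧ ψ) h = ⊨G-∧ (⟨⟩ν-sound φ h) (⟨⟩ν-sound ψ h)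
  ⟨⟩ν-sound (φ ∨ ψ) h = ⊨G-∨ (⟨⟩ν-sound φ h) (⟨⟩ν-sound ψ h)
  ⟨⟩ν-sound (X φ) h = ⊨G-X (⟨⟩ν-sound φ h)
  ⟨⟩ν-sound (φ W ψ) h = ⊨G-W (⟨⟩ν-sound φ h) (⟨⟩ν-sound ψ h)
  ⟨⟩ν-sound (φ R ψ) h = ⊨G-R (⟨⟩ν-sound φ h) (⟨⟩ν-sound ψ h)
  ⟨⟩ν-sound {C} (φ U ψ) h with G (F ψ) ∈? C
  ... | yes GFψ∈C = ⊨G-W⇒U (h ψ GFψ∈C) (⟨⟩ν-sound φ h) (⟨⟩ν-sound ψ h)
  ... | no _ = ⊨G-ff
  ⟨⟩ν-sound {C} (φ M ψ) h with G (F φ) ∈? C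
  ... | yes GFφ∈C = ⊨G-R⇒M (h φ GFφ∈C) (⟨⟩ν-sound φ h) (⟨⟩ν-sound ψ h)
  ... | no _ = ⊨G-ff

  BasisClosed : List (LTL n) → List (LTL n) → Set
  BasisClosed B ξs = ∀ {ξ} → ξ ∈ₗ ξs → basisOf ξ ⊆ B

  sf-basisClosed : ∀ φ → BasisClosed (basis φ) (sf φ)
  sf-basisClosed φ ξ∈sf b∈ = ∈-concatMap⁺ basisOf {xs = sf φ} (Any.map (λ { refl → b∈ }) ξ∈sf)

  BasisClosed-left : ∀ {B ξ} φ ψ → BasisClosed B (ξ ∷ sf φ ++ sf ψ) → BasisClosed B (sf φ)
  BasisClosed-left φ ψ hb m = hb (there (∈-++⁺ˡ m))

  BasisClosed-right : ∀ {B ξ} φ ψ → BasisClosed B (ξ ∷ sf φ ++ sf ψ) → BasisClosed B (sf ψ)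
  BasisClosed-right φ ψ hb m = hb (there (∈-++⁺ʳ (sf φ) m))

  AvoidsGF : List (LTL n) → List (LTL n) → Word n → Set
  AvoidsGF C B u = ∀ χ → G (F χ) ∈ₗ B → G (F χ) ∉ₗ C → ¬ (u ⊨ G (F χ))

  module _ (em : ExcludedMiddle 0ℓ) {C B : List (LTL n)} {u : Word n} (avoid : AvoidsGF C B u) where

    ⟨⟩ν-complete : ∀ χ → BasisClosed B (sf χ) → Eventually (λ j → suffix u j ⊨G χ ⇒ χ ⟨ C ⟩ν)
    ⟨⟩ν-complete tt _ = 0 , λ _ _ → ⊨G-refl
    ⟨⟩ν-complete ff _ = 0 , λ _ _ → ⊨G-refl
    ⟨⟩ν-complete (at a) _ = 0 , λ _ _ → ⊨G-refl
    ⟨⟩ν-complete (nat a) _ = 0 , λ _ _ → ⊨G-refl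
    ⟨⟩ν-complete (φ ∧ ψ) hb = Eventually-zipWith (λ _ → ⊨G-∧)
      (⟨⟩ν-complete φ (BasisClosed-left φ ψ hb)) (⟨⟩ν-complete ψ (BasisClosed-right φ ψ hb))
    ⟨⟩ν-complete (φ ∨ ψ) hb = Eventually-zipWith (λ _ → ⊨G-∨)
      (⟨⟩ν-complete φ (BasisClosed-left φ ψ hb)) (⟨⟩ν-complete ψ (BasisClosed-right φ ψ hb))
    ⟨⟩ν-complete (X φ) hb = Eventually-map (λ _ → ⊨G-X) (⟨⟩ν-complete φ (hb ∘ there))
    ⟨⟩ν-complete (φ W ψ) hb = Eventually-zipWith (λ _ → ⊨G-W)
      (⟨⟩ν-complete φ (BasisClosed-left φ ψ hb)) (⟨⟩ν-complete ψ (BasisClosed-right φ ψ hb))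
    ⟨⟩ν-complete (φ R ψ) hb = Eventually-zipWith (λ _ → ⊨G-R)
      (⟨⟩ν-complete φ (BasisClosed-left φ ψ hb)) (⟨⟩ν-complete ψ (BasisClosed-right φ ψ hb))
    ⟨⟩ν-complete (φ U ψ) hb with G (F ψ) ∈? C
    ... | yes _ = Eventually-zipWith (λ _ → ⊨G-U⇒W)
      (⟨⟩ν-complete φ (BasisClosed-left φ ψ hb)) (⟨⟩ν-complete ψ (BasisClosed-right φ ψ hb))
    ... | no GFψ∉C =
      Eventually-map (λ j never → ⊨G-U⇒ff λ k → never k ∘ suffix-suffix⁺ ψ u j k)
        (Eventually-always (¬GF⇒FG¬ em ψ u (avoid ψ (hb (here refl) (here refl)) GFψ∉C)))
    ⟨⟩ν-complete (φ M ψ) hb with G (F φ) ∈? C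
    ... | yes _ = Eventually-zipWith (λ _ → ⊨G-M⇒R)
      (⟨⟩ν-complete φ (BasisClosed-left φ ψ hb)) (⟨⟩ν-complete ψ (BasisClosed-right φ ψ hb))
    ... | no GFφ∉C =
      Eventually-map (λ j never → ⊨G-M⇒ff λ k → never k ∘ suffix-suffix⁺ φ u j k)
        (Eventually-always (¬GF⇒FG¬ em φ u (avoid φ (hb (here refl) (here refl)) GFφ∉C)))

lemma4p17 : ExcludedMiddle 0ℓ → {n : ℕ} (ψ : LTL n) (C : List (LTL n)) →
    C ⊆ basis (G ψ) →
    EquivUnder C (basis (G ψ)) (G ψ) (ψ U G (ψ ⟨ C ⟩ν))
    × EquivUnder C (basis (G ψ)) (ψ U G (ψ ⟨ C ⟩ν)) (G (ψ ⟨ C ⟩ν) R ψ)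
    × EquivUnder C (basis (G ψ)) (G ψ) (G (ψ ⟨ C ⟩ν) R ψ)
lemma4p17 em ψ C _ = G⇔U , (λ w l → G⇔R w l ⇔-∘ ⇔-sym (G⇔U w l)) , G⇔R
  where
  B = basis (G ψ)

  ψ-basisClosed : BasisClosed B (sf ψ)
  ψ-basisClosed = BasisClosed-left ψ ff (sf-basisClosed (G ψ))

  Gν⇒Gψ : ∀ {w} → InLang C B w → ∀ k → suffix w k ⊨ G (ψ ⟨ C ⟩ν) → suffix w k ⊨ G ψ
  Gν⇒Gψ {w} (sat , _) k = G-mp (⊨G-suffix (⟨⟩ν-sound {u = w} ψ (λ _ → All.lookup sat)) k)

  G⇔U : EquivUnder C B (G ψ) (ψ U G (ψ ⟨ C ⟩ν))
  G⇔U w l@(_ , avoid) = mk⇔ to (λ (k , Gν , before) → G-from-prefix ψ w k (Gν⇒Gψ l k Gν) before)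
    where
    to : w ⊨ G ψ → w ⊨ ψ U G (ψ ⟨ C ⟩ν)
    to Gψ with ⟨⟩ν-complete em {u = w} (λ χ → avoid (G (F χ))) ψ ψ-basisClosed
    ... | i , ψ⇒ν = i , G-mp (ψ⇒ν i ≤-refl) (G-suffix ψ w i Gψ) , λ j _ → G-always ψ w Gψ j

  G⇔R : EquivUnder C B (G ψ) (G (ψ ⟨ C ⟩ν) R ψ)
  G⇔R w l = mk⇔ (inj₁ ∘ G-always ψ w) from
    where
    from : w ⊨ G (ψ ⟨ C ⟩ν) R ψ → w ⊨ G ψ
    from (inj₁ always) = inj₁ always
    from (inj₂ (k , Gν , upto)) = G-from-prefix ψ w k (Gν⇒Gψ l k Gν) (λ j → upto j ∘ <⇒≤)
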